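{- Let $G=(V,E)$ be a finite multigraph (loops allowed) with $|E|=2|V|-1$. If $E$ is the disjoint union of the edge sets of a spanning tree of $G$ and a connected spanning map-graph of $G$, then $G$ is a $P(2,1)$-graph and $G$ contains a unique subgraph that is a $(2,2)$-circuit.
   Context: A map-graph is a graph each of whose connected components contains exactly one cycle (a loop counts as a cycle). A graph is $(k,\ell)$-sparse if every subgraph $(V',E')$ with at least one edge has $|E'|\le k|V'|-\ell$, and $(k,\ell)$-tight if additionally $|E|=k|V|-\ell$. A $P(2,1)$-graph is a $(2,1)$-tight graph $G$ such that $G-e$ is $(2,2)$-tight for some edge $e$. A $(2,2)$-circuit is a graph $H$ with $|E(H)|=2|V(H)|-1$ such that $H-e$ is $(2,2)$-tight for every edge $e$ of $H$. -}

module Defs where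

open import Data.Nat using (ℕ; _+_; _*_; _≤_)
open import Data.Bool using (Bool; true; false; _∧_)
open import Data.Fin using (Fin; _≟_)
open import Data.Fin.Subset using (Subset; _∈_; _⊆_; ∣_∣; Nonempty; ⊤; _-_)
open import Data.Product using (_×_; _,_; proj₁; proj₂; Σ; ∃)
open import Data.Sum using (_⊎_)
import Data.Empty
open import Data.Vec using (tabulate; lookup)
open import Relation.Nullary using (does)
open import Relation.Binary.PropositionalEquality using (_≡_)

-- A finite multigraph (loops and parallel edges allowed):
-- vertices Fin n, edges Fin m, each edge e has endpoints ends e = (u , v).
-- (The orientation of the pair is irrelevant; everything below is undirected.)
record Graph : Set where
  field
    n    : ℕ
    m    : ℕ
    ends : Fin m → Fin n × Fin n
open Graph public

module _ (G : Graph) where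

  src tgt : Fin (m G) → Fin (n G)
  src e = proj₁ (ends G e)
  tgt e = proj₂ (ends G e)

  Closed : Subset (n G) → Subset (m G) → Set
  Closed Vs Es = ∀ e → e ∈ Es → (src e ∈ Vs) × (tgt e ∈ Vs)

  -- The subgraph (Vs , Es) is (k,ℓ)-sparse: every subgraph (Vs', Es') of it
  -- with at least one edge has |Es'| ≤ k|Vs'| - ℓ (written without truncated
  -- subtraction as |Es'| + ℓ ≤ k|Vs'|).
  SparseOn : ℕ → ℕ → Subset (n G) → Subset (m G) → Set
  SparseOn k ℓ Vs Es =
    ∀ (Vs' : Subset (n G)) (Es' : Subset (m G)) →
      Vs' ⊆ Vs → Es' ⊆ Es → Closed Vs' Es' → Nonempty Es' →
      ∣ Es' ∣ + ℓ ≤ k * ∣ Vs' ∣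

  TightOn : ℕ → ℕ → Subset (n G) → Subset (m G) → Set
  TightOn k ℓ Vs Es = SparseOn k ℓ Vs Es × (∣ Es ∣ + ℓ ≡ k * ∣ Vs ∣)

  Tight : ℕ → ℕ → Set
  Tight k ℓ = TightOn k ℓ ⊤ ⊤

  P21 : Set
  P21 = Tight 2 1 × ∃ λ (e : Fin (m G)) → TightOn 2 2 ⊤ (⊤ - e)

  Circuit22 : Subset (n G) → Subset (m G) → Set
  Circuit22 Vs Es =
    Closed Vs Es × (∣ Es ∣ + 1 ≡ 2 * ∣ Vs ∣) ×
    (∀ e → e ∈ Es → TightOn 2 2 Vs (Es - e))

  data Reach (Es : Subset (m G)) : Fin (n G) → Fin (n G) → Set where
    here : ∀ {u} → Reach Es u u
    fwd  : ∀ {u w} e → e ∈ Es → src e ≡ u → Reach Es (tgt e) w → Reach Es u w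
    bwd  : ∀ {u w} e → e ∈ Es → tgt e ≡ u → Reach Es (src e) w → Reach Es u w

  -- Degree of v in the edge set Es (a loop at v contributes 2).
  deg : Subset (m G) → Fin (n G) → ℕ
  deg Es v =
    ∣ tabulate (λ e → lookup Es e ∧ does (src e ≟ v)) ∣ +
    ∣ tabulate (λ e → lookup Es e ∧ does (tgt e ≟ v)) ∣

  -- Loops are cycles of length 1, a pair of
  -- parallel edges is a cycle of length 2.
  IsCycle : Subset (m G) → Set
  IsCycle C =
    Nonempty C ×
    (∀ v → (deg C v ≡ 0) ⊎ (deg C v ≡ 2)) ×
    (∀ e f → e ∈ C → f ∈ C → Reach C (src e) (src f))

  SpanningConnected : Subset (m G) → Set
  SpanningConnected Es = ∀ u v → Reach Es u v

  SpanningTree : Subset (m G) → Set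
  SpanningTree T =
    SpanningConnected T × (∀ C → C ⊆ T → IsCycle C → Data.Empty.⊥)

  ConnectedSpanningMapGraph : Subset (m G) → Set
  ConnectedSpanningMapGraph M =
    SpanningConnected M ×
    Σ (Subset (m G)) λ C → C ⊆ M × IsCycle C ×
      (∀ C' → C' ⊆ M → IsCycle C' → C' ≡ C)

-- Let c be an edge of the cycle of M.  Then T and M - c are forests.  A
-- forest has at most |V'| - 1 edges in any nonempty subgraph (V', E'); this
-- is the heart of the proof (module Forests): a minimal edge set meeting at
-- most as many vertices as it has edges is shown to be a cycle, using the
-- handshake lemma for 2-regularity and a breadth-first component for
-- connectivity.  Counting with the two forests (module TwoForests) gives
-- that G is (2,1)-sparse and G - c is (2,2)-sparse; with |E| = 2|V| - 1 this
-- is the P(2,1) property.  Finally (module Circuits) a minimal overfull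
-- subgraph of a (2,1)-sparse graph is a (2,2)-circuit, every circuit must
-- contain c, and two circuits through c coincide by an inclusion–exclusion
-- count.
module Submission where

open import Defs
open import Data.Nat using (ℕ; zero; suc; _+_; _*_; _≤_; _<_; z≤n; s≤s)
open import Data.Nat.Properties hiding (_≟_)
open import Data.Nat.Tactic.RingSolver using (solve-∀)
open import Data.Bool using (Bool; true; false; _∧_)
open import Data.Fin using (Fin; zero; suc; _≟_)
open import Data.Fin.Properties using (any?; all?)
open import Data.Fin.Subset
open import Data.Fin.Subset.Properties
open import Data.Product using (_×_; _,_; proj₁; proj₂; Σ; ∃)
open import Data.Sum using (_⊎_; inj₁; inj₂)
import Data.Empty
open import Data.Empty using (⊥-elim)
open import Data.Vec using ([]; _∷_; there; lookup; tabulate)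
open import Data.Vec.Properties using (lookup∘tabulate; tabulate∘lookup; []=⇒lookup; lookup⇒[]=)
open import Relation.Nullary using (¬_; Dec; yes; no; does; contradiction; ¬?)
open import Relation.Nullary.Decidable using (_×-dec_; _⊎-dec_; _→-dec_; dec-true)
open import Relation.Unary using (Decidable)
open import Relation.Binary.PropositionalEquality
open import Function using (_∘_)
open import Algebra.Properties.CommutativeMonoid.Sum +-0-commutativeMonoid
  using (sum; sum-cong-≗; ∑-distrib-+; ∑-comm; sum-replicate-zero)
open import Algebra.Properties.Semiring.Sum +-*-semiring using (*-distribˡ-sum)

∣p∪q∣+∣p∩q∣≡∣p∣+∣q∣ : ∀ {k} (p q : Subset k) → ∣ p ∪ q ∣ + ∣ p ∩ q ∣ ≡ ∣ p ∣ + ∣ q ∣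
∣p∪q∣+∣p∩q∣≡∣p∣+∣q∣ []            []            = refl
∣p∪q∣+∣p∩q∣≡∣p∣+∣q∣ (true  ∷ p) (true  ∷ q) =
  cong suc (trans (+-suc _ _) (trans (cong suc (∣p∪q∣+∣p∩q∣≡∣p∣+∣q∣ p q)) (sym (+-suc _ _))))
∣p∪q∣+∣p∩q∣≡∣p∣+∣q∣ (true  ∷ p) (false ∷ q) = cong suc (∣p∪q∣+∣p∩q∣≡∣p∣+∣q∣ p q)
∣p∪q∣+∣p∩q∣≡∣p∣+∣q∣ (false ∷ p) (true  ∷ q) =
  trans (cong suc (∣p∪q∣+∣p∩q∣≡∣p∣+∣q∣ p q)) (sym (+-suc _ _))
∣p∪q∣+∣p∩q∣≡∣p∣+∣q∣ (false ∷ p) (false ∷ q) = ∣p∪q∣+∣p∩q∣≡∣p∣+∣q∣ p q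

∣p∪q∣≤∣p∣+∣q∣ : ∀ {k} (p q : Subset k) → ∣ p ∪ q ∣ ≤ ∣ p ∣ + ∣ q ∣
∣p∪q∣≤∣p∣+∣q∣ p q = ≤-trans (m≤m+n _ _) (≤-reflexive (∣p∪q∣+∣p∩q∣≡∣p∣+∣q∣ p q))

covered-by : ∀ {k} {p q r : Subset k} → p ⊆ q ∪ r → ∣ p ∣ ≤ ∣ q ∣ + ∣ r ∣
covered-by {q = q} {r} p⊆q∪r = ≤-trans (p⊆q⇒∣p∣≤∣q∣ p⊆q∪r) (∣p∪q∣≤∣p∣+∣q∣ q r)

∣empty∣≡0 : ∀ {k} {p : Subset k} → ¬ Nonempty p → ∣ p ∣ ≡ 0
∣empty∣≡0 {k} empty rewrite Empty-unique empty = ∣⊥∣≡0 k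

x∈p⇒1≤∣p∣ : ∀ {k} {x : Fin k} {p : Subset k} → x ∈ p → 1 ≤ ∣ p ∣
x∈p⇒1≤∣p∣ {x = x} x∈p =
  ≤-trans (≤-reflexive (sym (∣⁅x⁆∣≡1 x))) (p⊆q⇒∣p∣≤∣q∣ λ y∈⁅x⁆ → subst (_∈ _) (sym (x∈⁅y⁆⇒x≡y x y∈⁅x⁆)) x∈p)

x∉p-x : ∀ {k} (p : Subset k) (x : Fin k) → x ∉ p - x
x∉p-x (_ ∷ p) zero    ()
x∉p-x (_ ∷ p) (suc x) (there x∈p-x) = x∉p-x p x x∈p-x

x∈p-y⇒x≢y : ∀ {k} {p : Subset k} {x y : Fin k} → x ∈ p - y → x ≢ y
x∈p-y⇒x≢y {p = p} {x} x∈p-x refl = x∉p-x p x x∈p-x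

∣p-x∣+1≡∣p∣ : ∀ {k} {x : Fin k} {p : Subset k} → x ∈ p → ∣ p - x ∣ + 1 ≡ ∣ p ∣
∣p-x∣+1≡∣p∣ {x = x} {p} x∈p = ≤-antisym
  (≤-trans (≤-reflexive (+-comm _ 1)) (x∈p⇒∣p-x∣<∣p∣ x∈p))
  (≤-trans (covered-by p⊆p-x∪x) (≤-reflexive (cong (∣ p - x ∣ +_) (∣⁅x⁆∣≡1 x))))
  where
  p⊆p-x∪x : p ⊆ (p - x) ∪ ⁅ x ⁆
  p⊆p-x∪x {y} y∈p with y ≟ x
  ... | yes refl = x∈p∪q⁺ (inj₂ (x∈⁅x⁆ x))
  ... | no y≢x   = x∈p∪q⁺ (inj₁ (x∈p∧x≢y⇒x∈p-y y∈p y≢x))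

two-elements : ∀ {k} {x y : Fin k} {p : Subset k} → x ∈ p → y ∈ p → x ≢ y → 2 ≤ ∣ p ∣
two-elements x∈p y∈p x≢y =
  ≤-trans (s≤s (x∈p⇒1≤∣p∣ (x∈p∧x≢y⇒x∈p-y y∈p λ y≡x → x≢y (sym y≡x)))) (x∈p⇒∣p-x∣<∣p∣ x∈p)

disjoint⇒∣p∣+∣q∣≤∣r∣ : ∀ {k} {p q r : Subset k} → (∀ {x} → x ∈ p → x ∉ q) → p ∪ q ⊆ r →
  ∣ p ∣ + ∣ q ∣ ≤ ∣ r ∣
disjoint⇒∣p∣+∣q∣≤∣r∣ {p = p} {q} {r} disjoint p∪q⊆r = begin
  ∣ p ∣ + ∣ q ∣          ≡⟨ ∣p∪q∣+∣p∩q∣≡∣p∣+∣q∣ p q ⟨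
  ∣ p ∪ q ∣ + ∣ p ∩ q ∣  ≡⟨ cong (∣ p ∪ q ∣ +_) (∣empty∣≡0 p∩q-empty) ⟩
  ∣ p ∪ q ∣ + 0          ≡⟨ +-identityʳ _ ⟩
  ∣ p ∪ q ∣              ≤⟨ p⊆q⇒∣p∣≤∣q∣ p∪q⊆r ⟩
  ∣ r ∣                  ∎
  where
  open ≤-Reasoning
  p∩q-empty : ¬ Nonempty (p ∩ q)
  p∩q-empty (x , x∈p∩q) = disjoint (proj₁ (x∈p∩q⁻ p q x∈p∩q)) (proj₂ (x∈p∩q⁻ p q x∈p∩q))

∣p∣≤∣p∩q∣⇒p⊆q : ∀ {k} (p q : Subset k) → ∣ p ∣ ≤ ∣ p ∩ q ∣ → p ⊆ q
∣p∣≤∣p∩q∣⇒p⊆q p q ∣p∣≤∣p∩q∣ {x} x∈p with x ∈? q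
... | yes x∈q = x∈q
... | no  x∉q = contradiction ∣p∣≤∣p∩q∣
      (<⇒≱ (p⊂q⇒∣p∣<∣q∣ (p∩q⊆p p q , x , x∈p , λ x∈p∩q → x∉q (proj₂ (x∈p∩q⁻ p q x∈p∩q)))))

⟦_⟧ : ∀ {k} {P : Fin k → Set} → Decidable P → Subset k
⟦ P? ⟧ = tabulate (λ i → does (P? i))

∈⟦⟧⁺ : ∀ {k} {P : Fin k → Set} (P? : Decidable P) {i} → P i → i ∈ ⟦ P? ⟧
∈⟦⟧⁺ P? {i} Pi = lookup⇒[]= i _ (trans (lookup∘tabulate (λ j → does (P? j)) i) (dec-true (P? i) Pi))

∈⟦⟧⁻ : ∀ {k} {P : Fin k → Set} (P? : Decidable P) {i} → i ∈ ⟦ P? ⟧ → P i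
∈⟦⟧⁻ P? {i} i∈ = witness (P? i) (trans (sym (lookup∘tabulate (λ j → does (P? j)) i)) ([]=⇒lookup i∈))
  where
  witness : ∀ {A : Set} (A? : Dec A) → does A? ≡ true → A
  witness (yes a) _ = a
  witness (no _) ()

minimal-subset : ∀ {k} {P : Subset k → Set} → Decidable P → ∀ {p} → P p →
  ∃ λ q → P q × (∀ r → P r → ¬ ∣ r ∣ < ∣ q ∣)
minimal-subset {P = P} P? {p} Pp = descend ∣ p ∣ p ≤-refl Pp
  where
  descend : ∀ b q → ∣ q ∣ ≤ b → P q → ∃ λ q → P q × (∀ r → P r → ¬ ∣ r ∣ < ∣ q ∣)
  descend b q ∣q∣≤b Pq with anySubset? (λ r → P? r ×-dec (∣ r ∣ <? ∣ q ∣))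
  ... | no none = q , Pq , λ r Pr smaller → none (r , Pr , smaller)
  descend zero    q ∣q∣≤0   Pq | yes (r , Pr , smaller) = contradiction (≤-trans smaller ∣q∣≤0) λ ()
  descend (suc b) q ∣q∣≤1+b Pq | yes (r , Pr , smaller) = descend b r (≤-pred (≤-trans smaller ∣q∣≤1+b)) Pr

ind : Bool → ℕ
ind true  = 1
ind false = 0

∣tabulate∣≡sum : ∀ {k} (b : Fin k → Bool) → ∣ tabulate b ∣ ≡ sum (ind ∘ b)
∣tabulate∣≡sum {zero}  b = refl
∣tabulate∣≡sum {suc k} b with b zero
... | true  = cong suc (∣tabulate∣≡sum (b ∘ suc))
... | false = ∣tabulate∣≡sum (b ∘ suc)

∣p∣≡sum : ∀ {k} (p : Subset k) → ∣ p ∣ ≡ sum (ind ∘ lookup p)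
∣p∣≡sum p = trans (cong ∣_∣ (sym (tabulate∘lookup p))) (∣tabulate∣≡sum (lookup p))

sum-δ : ∀ {k} (a : Fin k) → sum (λ v → ind (does (a ≟ v))) ≡ 1
sum-δ {suc k} zero    = cong suc (sum-replicate-zero k)
sum-δ {suc k} (suc a) = sum-δ a

sum-mono : ∀ {k} {f g : Fin k → ℕ} → (∀ i → f i ≤ g i) → sum f ≤ sum g
sum-mono {zero}  f≤g = z≤n
sum-mono {suc k} f≤g = +-mono-≤ (f≤g zero) (sum-mono (f≤g ∘ suc))

sum-tight : ∀ {k} {f g : Fin k → ℕ} → (∀ i → f i ≤ g i) → sum g ≤ sum f → ∀ i → f i ≡ g i
sum-tight {suc k} {f} {g} f≤g Σg≤Σf zero = ≤-antisym (f≤g zero)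
  (+-cancelʳ-≤ (sum (f ∘ suc)) (g zero) (f zero)
    (≤-trans (+-monoʳ-≤ (g zero) (sum-mono (f≤g ∘ suc))) Σg≤Σf))
sum-tight {suc k} {f} {g} f≤g Σg≤Σf (suc i) = sum-tight (f≤g ∘ suc)
  (+-cancelˡ-≤ (f zero) _ _ (≤-trans (+-monoˡ-≤ (sum (g ∘ suc)) (f≤g zero)) Σg≤Σf)) i

module Subgraphs (G : Graph) where

  closed-⊆ : ∀ {Vs Es Es'} → Es' ⊆ Es → Closed G Vs Es → Closed G Vs Es'
  closed-⊆ Es'⊆Es closed e e∈Es' = closed e (Es'⊆Es e∈Es')

  closed-∩ : ∀ {V₁ V₂ E₁ E₂} → Closed G V₁ E₁ → Closed G V₂ E₂ → Closed G (V₁ ∩ V₂) (E₁ ∩ E₂)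
  closed-∩ {E₁ = E₁} {E₂} closed₁ closed₂ e e∈ with x∈p∩q⁻ E₁ E₂ e∈
  ... | e∈E₁ , e∈E₂ = x∈p∩q⁺ (proj₁ (closed₁ e e∈E₁) , proj₁ (closed₂ e e∈E₂)) ,
                      x∈p∩q⁺ (proj₂ (closed₁ e e∈E₁) , proj₂ (closed₂ e e∈E₂))

  closed-∪ : ∀ {V₁ V₂ E₁ E₂} → Closed G V₁ E₁ → Closed G V₂ E₂ → Closed G (V₁ ∪ V₂) (E₁ ∪ E₂)
  closed-∪ {E₁ = E₁} {E₂} closed₁ closed₂ e e∈ with x∈p∪q⁻ E₁ E₂ e∈
  ... | inj₁ e∈E₁ = x∈p∪q⁺ (inj₁ (proj₁ (closed₁ e e∈E₁))) , x∈p∪q⁺ (inj₁ (proj₂ (closed₁ e e∈E₁)))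
  ... | inj₂ e∈E₂ = x∈p∪q⁺ (inj₂ (proj₁ (closed₂ e e∈E₂))) , x∈p∪q⁺ (inj₂ (proj₂ (closed₂ e e∈E₂)))

module Incidence (G : Graph) where

  Touches : Fin (m G) → Fin (n G) → Set
  Touches e v = src G e ≡ v ⊎ tgt G e ≡ v

  leaving entering : Subset (m G) → Fin (n G) → Subset (m G)
  leaving  E v = tabulate (λ e → lookup E e ∧ does (src G e ≟ v))
  entering E v = tabulate (λ e → lookup E e ∧ does (tgt G e ≟ v))

  ∈-ends : ∀ {E e v} (h : Fin (m G) → Fin (n G)) → e ∈ E → h e ≡ v →
    e ∈ tabulate (λ f → lookup E f ∧ does (h f ≟ v))
  ∈-ends {E} {e} {v} h e∈E he≡v = lookup⇒[]= e _
    (trans (lookup∘tabulate (λ f → lookup E f ∧ does (h f ≟ v)) e)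
           (cong₂ _∧_ ([]=⇒lookup e∈E) (dec-true (h e ≟ v) he≡v)))

  sum-endpoint : ∀ E (h : Fin (m G) → Fin (n G)) →
    sum (λ v → ∣ tabulate (λ e → lookup E e ∧ does (h e ≟ v)) ∣) ≡ ∣ E ∣
  sum-endpoint E h = begin
    sum (λ v → ∣ tabulate (λ e → lookup E e ∧ does (h e ≟ v)) ∣)
      ≡⟨ sum-cong-≗ (λ v → ∣tabulate∣≡sum (λ e → lookup E e ∧ does (h e ≟ v))) ⟩
    sum (λ v → sum (λ e → ind (lookup E e ∧ does (h e ≟ v))))
      ≡⟨ ∑-comm (λ v e → ind (lookup E e ∧ does (h e ≟ v))) ⟩
    sum (λ e → sum (λ v → ind (lookup E e ∧ does (h e ≟ v))))
      ≡⟨ sum-cong-≗ (λ e → once (lookup E e) (h e)) ⟩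
    sum (ind ∘ lookup E)
      ≡⟨ sym (∣p∣≡sum E) ⟩
    ∣ E ∣ ∎
    where
    open ≡-Reasoning
    once : ∀ b (a : Fin (n G)) → sum (λ v → ind (b ∧ does (a ≟ v))) ≡ ind b
    once true  a = sum-δ a
    once false a = sum-replicate-zero (n G)

  handshake : ∀ E → sum (deg G E) ≡ 2 * ∣ E ∣
  handshake E = begin
    sum (λ v → ∣ leaving E v ∣ + ∣ entering E v ∣)
      ≡⟨ ∑-distrib-+ (λ v → ∣ leaving E v ∣) (λ v → ∣ entering E v ∣) ⟩
    sum (λ v → ∣ leaving E v ∣) + sum (λ v → ∣ entering E v ∣)
      ≡⟨ cong₂ _+_ (sum-endpoint E (src G)) (sum-endpoint E (tgt G)) ⟩
    ∣ E ∣ + ∣ E ∣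
      ≡⟨ cong (∣ E ∣ +_) (sym (+-identityʳ ∣ E ∣)) ⟩
    2 * ∣ E ∣ ∎
    where open ≡-Reasoning

  two-edges⇒deg≥2 : ∀ {E e f v} → e ∈ E → f ∈ E → e ≢ f → Touches e v → Touches f v → 2 ≤ deg G E v
  two-edges⇒deg≥2 e∈ f∈ e≢f (inj₁ se) (inj₁ sf) =
    ≤-trans (two-elements (∈-ends (src G) e∈ se) (∈-ends (src G) f∈ sf) e≢f) (m≤m+n _ _)
  two-edges⇒deg≥2 e∈ f∈ e≢f (inj₂ te) (inj₂ tf) =
    ≤-trans (two-elements (∈-ends (tgt G) e∈ te) (∈-ends (tgt G) f∈ tf) e≢f) (m≤n+m _ _)
  two-edges⇒deg≥2 e∈ f∈ e≢f (inj₁ se) (inj₂ tf) =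
    +-mono-≤ (x∈p⇒1≤∣p∣ (∈-ends (src G) e∈ se)) (x∈p⇒1≤∣p∣ (∈-ends (tgt G) f∈ tf))
  two-edges⇒deg≥2 e∈ f∈ e≢f (inj₂ te) (inj₁ sf) =
    +-mono-≤ (x∈p⇒1≤∣p∣ (∈-ends (src G) f∈ sf)) (x∈p⇒1≤∣p∣ (∈-ends (tgt G) e∈ te))

  loop⇒deg≥2 : ∀ {E e v} → e ∈ E → src G e ≡ v → tgt G e ≡ v → 2 ≤ deg G E v
  loop⇒deg≥2 e∈ se te = +-mono-≤ (x∈p⇒1≤∣p∣ (∈-ends (src G) e∈ se)) (x∈p⇒1≤∣p∣ (∈-ends (tgt G) e∈ te))

  Touched : Subset (m G) → Fin (n G) → Set
  Touched E v = ∃ λ e → e ∈ E × Touches e v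

  touched? : ∀ E → Decidable (Touched E)
  touched? E v = any? (λ e → (e ∈? E) ×-dec ((src G e ≟ v) ⊎-dec (tgt G e ≟ v)))

  support : Subset (m G) → Subset (n G)
  support E = ⟦ touched? E ⟧

  support⁺ : ∀ {E e v} → e ∈ E → Touches e v → v ∈ support E
  support⁺ {E} e∈ touch = ∈⟦⟧⁺ (touched? E) (_ , e∈ , touch)

  support⁻ : ∀ {E v} → v ∈ support E → Touched E v
  support⁻ {E} = ∈⟦⟧⁻ (touched? E)

  support-mono : ∀ {E E'} → E ⊆ E' → support E ⊆ support E'
  support-mono E⊆E' v∈ with support⁻ v∈
  ... | e , e∈ , touch = support⁺ (E⊆E' e∈) touch

  closed⇒support⊆ : ∀ {Vs E} → Closed G Vs E → support E ⊆ Vs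
  closed⇒support⊆ closed v∈ with support⁻ v∈
  ... | e , e∈ , inj₁ refl = proj₁ (closed e e∈)
  ... | e , e∈ , inj₂ refl = proj₂ (closed e e∈)

module Walks (G : Graph) where

  reach-trans : ∀ {E u v w} → Reach G E u v → Reach G E v w → Reach G E u w
  reach-trans here                 r = r
  reach-trans (fwd e e∈ refl walk) r = fwd e e∈ refl (reach-trans walk r)
  reach-trans (bwd e e∈ refl walk) r = bwd e e∈ refl (reach-trans walk r)

  -- The vertices reachable from s₀ along E, computed as the limit of the
  -- breadth-first layers {s₀} ⊆ grow {s₀} ⊆ grow (grow {s₀}) ⊆ …, which
  -- stabilises after at most n G steps.
  module Component (E : Subset (m G)) (s₀ : Fin (n G)) where

    Adjacent : Subset (n G) → Fin (n G) → Set
    Adjacent S v = ∃ λ e → e ∈ E × ((src G e ∈ S × tgt G e ≡ v) ⊎ (tgt G e ∈ S × src G e ≡ v))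

    adjacent? : ∀ S → Decidable (Adjacent S)
    adjacent? S v = any? (λ e → (e ∈? E) ×-dec
      (((src G e ∈? S) ×-dec (tgt G e ≟ v)) ⊎-dec ((tgt G e ∈? S) ×-dec (src G e ≟ v))))

    in-or-adjacent? : ∀ S → Decidable (λ v → v ∈ S ⊎ Adjacent S v)
    in-or-adjacent? S v = (v ∈? S) ⊎-dec adjacent? S v

    grow : Subset (n G) → Subset (n G)
    grow S = ⟦ in-or-adjacent? S ⟧

    S⊆grow : ∀ S → S ⊆ grow S
    S⊆grow S v∈S = ∈⟦⟧⁺ (in-or-adjacent? S) (inj₁ v∈S)

    Saturated : Subset (n G) → Set
    Saturated S = ∀ e → e ∈ E → (src G e ∈ S → tgt G e ∈ S) × (tgt G e ∈ S → src G e ∈ S)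

    grow⊆⇒saturated : ∀ {S} → grow S ⊆ S → Saturated S
    grow⊆⇒saturated {S} grow⊆ e e∈ =
      (λ s∈ → grow⊆ (∈⟦⟧⁺ (in-or-adjacent? S) (inj₂ (e , e∈ , inj₁ (s∈ , refl))))) ,
      (λ t∈ → grow⊆ (∈⟦⟧⁺ (in-or-adjacent? S) (inj₂ (e , e∈ , inj₂ (t∈ , refl)))))

    saturated⇒grow⊆ : ∀ {S} → Saturated S → grow S ⊆ S
    saturated⇒grow⊆ {S} sat v∈ with ∈⟦⟧⁻ (in-or-adjacent? S) v∈
    ... | inj₁ v∈S                         = v∈S
    ... | inj₂ (e , e∈ , inj₁ (s∈ , refl)) = proj₁ (sat e e∈) s∈
    ... | inj₂ (e , e∈ , inj₂ (t∈ , refl)) = proj₂ (sat e e∈) t∈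

    stuck⇒saturated : ∀ {S} → ¬ (S ⊂ grow S) → Saturated S
    stuck⇒saturated {S} stuck = grow⊆⇒saturated grow⊆
      where
      grow⊆ : grow S ⊆ S
      grow⊆ {v} v∈ with v ∈? S
      ... | yes v∈S = v∈S
      ... | no  v∉S = contradiction ((λ {w} → S⊆grow S {w}) , v , v∈ , v∉S) stuck

    saturated-grow : ∀ {S} → Saturated S → Saturated (grow S)
    saturated-grow {S} sat rewrite ⊆-antisym (saturated⇒grow⊆ sat) (S⊆grow S) = sat

    layer : ℕ → Subset (n G)
    layer zero    = ⁅ s₀ ⁆
    layer (suc k) = grow (layer k)

    s₀∈layer : ∀ k → s₀ ∈ layer k
    s₀∈layer zero    = x∈⁅x⁆ s₀
    s₀∈layer (suc k) = S⊆grow (layer k) (s₀∈layer k)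

    layer-reach : ∀ k {v} → v ∈ layer k → Reach G E s₀ v
    layer-reach zero    v∈ rewrite x∈⁅y⁆⇒x≡y s₀ v∈ = here
    layer-reach (suc k) v∈ with ∈⟦⟧⁻ (in-or-adjacent? (layer k)) v∈
    ... | inj₁ v∈layer                     = layer-reach k v∈layer
    ... | inj₂ (e , e∈ , inj₁ (s∈ , refl)) = reach-trans (layer-reach k s∈) (fwd e e∈ refl here)
    ... | inj₂ (e , e∈ , inj₂ (t∈ , refl)) = reach-trans (layer-reach k t∈) (bwd e e∈ refl here)

    layer-progress : ∀ k → Saturated (layer k) ⊎ k < ∣ layer k ∣
    layer-progress zero = inj₂ (≤-reflexive (sym (∣⁅x⁆∣≡1 s₀)))
    layer-progress (suc k) with layer-progress k
    ... | inj₁ sat = inj₁ (saturated-grow sat)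
    ... | inj₂ k<∣layer∣ with layer k ⊂? grow (layer k)
    ...   | yes grows = inj₂ (≤-trans (s≤s k<∣layer∣) (p⊂q⇒∣p∣<∣q∣ grows))
    ...   | no  stuck = inj₁ (saturated-grow (stuck⇒saturated stuck))

    component : Subset (n G)
    component = layer (n G)

    s₀∈component : s₀ ∈ component
    s₀∈component = s₀∈layer (n G)

    component-reach : ∀ {v} → v ∈ component → Reach G E s₀ v
    component-reach = layer-reach (n G)

    component-saturated : Saturated component
    component-saturated with layer-progress (n G)
    ... | inj₁ sat = sat
    ... | inj₂ big = contradiction (∣p∣≤n component) (<⇒≱ big)

-- A nonempty edge set is dense when it meets at most as many
-- vertices as it has edges; a minimal dense set is shown to be a cycle.
module Forests (G : Graph) where
  open Subgraphs G
  open Incidence G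
  open Walks G

  Dense : Subset (m G) → Set
  Dense E = Nonempty E × ∣ support E ∣ ≤ ∣ E ∣

  dense? : Decidable Dense
  dense? E = nonempty? E ×-dec (∣ support E ∣ ≤? ∣ E ∣)

  Acyclic : Subset (m G) → Set
  Acyclic F = ∀ C → C ⊆ F → IsCycle G C → Data.Empty.⊥

  module MinimalDense (E : Subset (m G)) (dense : Dense E)
                      (minimal : ∀ E' → E' ⊆ E → Dense E' → ¬ ∣ E' ∣ < ∣ E ∣) where

    sparse-below : ∀ {E'} → E' ⊆ E → Nonempty E' → ∣ E' ∣ < ∣ E ∣ → ∣ E' ∣ < ∣ support E' ∣
    sparse-below {E'} E'⊆E nonempty smaller with ∣ support E' ∣ ≤? ∣ E' ∣
    ... | yes d = contradiction smaller (minimal E' E'⊆E (nonempty , d))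
    ... | no ¬d = ≰⇒> ¬d

    E-f⊆E : ∀ f → E - f ⊆ E
    E-f⊆E f = p─q⊆p E ⁅ f ⁆

    ∣support∣≡∣E∣ : ∣ support E ∣ ≡ ∣ E ∣
    ∣support∣≡∣E∣ = ≤-antisym (proj₂ dense) (∣E∣≤∣support∣ (proj₂ (proj₁ dense)))
      where
      ∣E∣≤∣support∣ : ∀ {f} → f ∈ E → ∣ E ∣ ≤ ∣ support E ∣
      ∣E∣≤∣support∣ {f} f∈E with nonempty? (E - f)
      ... | yes nonempty = begin
        ∣ E ∣                 ≡⟨ trans (sym (∣p-x∣+1≡∣p∣ f∈E)) (+-comm _ 1) ⟩
        suc ∣ E - f ∣         ≤⟨ sparse-below (E-f⊆E f) nonempty (x∈p⇒∣p-x∣<∣p∣ f∈E) ⟩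
        ∣ support (E - f) ∣   ≤⟨ p⊆q⇒∣p∣≤∣q∣ (support-mono (E-f⊆E f)) ⟩
        ∣ support E ∣         ∎
        where open ≤-Reasoning
      ... | no empty = begin
        ∣ E ∣                 ≡⟨ sym (∣p-x∣+1≡∣p∣ f∈E) ⟩
        ∣ E - f ∣ + 1         ≡⟨ cong (_+ 1) (∣empty∣≡0 empty) ⟩
        1                     ≤⟨ x∈p⇒1≤∣p∣ (support⁺ f∈E (inj₁ refl)) ⟩
        ∣ support E ∣         ∎
        where open ≤-Reasoning

    -- No vertex of E is met by exactly one edge that is not a loop: removing
    -- that edge would leave a smaller dense set (or a single non-loop edge).
    no-pendant : ∀ {f v} → f ∈ E → Touches f v → src G f ≢ tgt G f →
      (∀ g → g ∈ E → g ≢ f → ¬ Touches g v) → Data.Empty.⊥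
    no-pendant {f} {v} f∈E f-touches non-loop alone with nonempty? (E - f)
    ... | yes nonempty = <⇒≱ (sparse-below (E-f⊆E f) nonempty (x∈p⇒∣p-x∣<∣p∣ f∈E)) (begin
      ∣ support (E - f) ∣   ≤⟨ p⊆q⇒∣p∣≤∣q∣ support⊆ ⟩
      ∣ support E - v ∣     ≡⟨ +-cancelʳ-≡ 1 _ _ (begin-equality
        ∣ support E - v ∣ + 1  ≡⟨ ∣p-x∣+1≡∣p∣ (support⁺ f∈E f-touches) ⟩
        ∣ support E ∣          ≡⟨ ∣support∣≡∣E∣ ⟩
        ∣ E ∣                  ≡⟨ ∣p-x∣+1≡∣p∣ f∈E ⟨
        ∣ E - f ∣ + 1          ∎) ⟩
      ∣ E - f ∣             ∎)
      where
      open ≤-Reasoning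
      support⊆ : support (E - f) ⊆ support E - v
      support⊆ w∈ with support⁻ w∈
      ... | g , g∈E-f , g-touches = x∈p∧x≢y⇒x∈p-y (support-mono (E-f⊆E f) w∈)
        λ { refl → alone g (E-f⊆E f g∈E-f) (x∈p-y⇒x≢y g∈E-f) g-touches }
    ... | no empty = <⇒≱ (two-elements (support⁺ f∈E (inj₁ refl)) (support⁺ f∈E (inj₂ refl)) non-loop)
      (≤-reflexive (trans ∣support∣≡∣E∣ (trans (sym (∣p-x∣+1≡∣p∣ f∈E)) (cong (_+ 1) (∣empty∣≡0 empty)))))

    deg≥2 : ∀ {v} → v ∈ support E → 2 ≤ deg G E v
    deg≥2 {v} v∈ with support⁻ v∈
    ... | f , f∈E , f-touches
        with any? (λ g → (g ∈? E) ×-dec (¬? (g ≟ f) ×-dec ((src G g ≟ v) ⊎-dec (tgt G g ≟ v))))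
    ...   | yes (g , g∈E , g≢f , g-touches) =
            two-edges⇒deg≥2 f∈E g∈E (λ f≡g → g≢f (sym f≡g)) f-touches g-touches
    ...   | no no-other with src G f ≟ tgt G f
    ...     | yes loop = loop⇒deg≥2 f∈E (source-at f-touches) (trans (sym loop) (source-at f-touches))
      where
      source-at : Touches f v → src G f ≡ v
      source-at (inj₁ s≡v) = s≡v
      source-at (inj₂ t≡v) = trans loop t≡v
    ...     | no non-loop = ⊥-elim (no-pendant f∈E f-touches non-loop
                              λ g g∈E g≢f g-touches → no-other (g , g∈E , g≢f , g-touches))

    -- By the handshake lemma and |support E| = |E|, the bound deg ≥ 2 on the
    -- support is attained everywhere.
    deg≡2·[∈support] : ∀ v → 2 * ind (lookup (support E) v) ≡ deg G E v
    deg≡2·[∈support] = sum-tight lower (≤-reflexive total)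
      where
      lower : ∀ v → 2 * ind (lookup (support E) v) ≤ deg G E v
      lower v with lookup (support E) v in v∈?
      ... | true  = deg≥2 (lookup⇒[]= v _ v∈?)
      ... | false = z≤n
      total : sum (deg G E) ≡ sum (λ v → 2 * ind (lookup (support E) v))
      total = begin
        sum (deg G E)                          ≡⟨ handshake E ⟩
        2 * ∣ E ∣                              ≡⟨ cong (2 *_) (trans (sym ∣support∣≡∣E∣) (∣p∣≡sum (support E))) ⟩
        2 * sum (ind ∘ lookup (support E))     ≡⟨ *-distribˡ-sum 2 (ind ∘ lookup (support E)) ⟩
        sum (λ v → 2 * ind (lookup (support E) v)) ∎
        where open ≡-Reasoning

    two-regular : ∀ v → (deg G E v ≡ 0) ⊎ (deg G E v ≡ 2)
    two-regular v with lookup (support E) v | deg≡2·[∈support] v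
    ... | true  | 2≡deg = inj₂ (sym 2≡deg)
    ... | false | 0≡deg = inj₁ (sym 0≡deg)

    -- E cannot be split into two nonempty parts with disjoint supports:
    -- both parts would be sparse, so together they would meet more vertices
    -- than E has edges.
    no-split : ∀ K K' → K ⊆ E → K' ⊆ E → E ⊆ K ∪ K' → Nonempty K → Nonempty K' →
      (∀ {v} → v ∈ support K → v ∉ support K') → Data.Empty.⊥
    no-split K K' K⊆E K'⊆E E⊆K∪K' (e , e∈K) (f , f∈K') disjoint =
      <⇒≱ (s≤s (+-monoʳ-≤ ∣ K ∣ (n≤1+n ∣ K' ∣))) (begin
        suc ∣ K ∣ + suc ∣ K' ∣          ≤⟨ +-mono-≤ (sparse-below K⊆E (e , e∈K) K⊂E)
                                                   (sparse-below K'⊆E (f , f∈K') K'⊂E) ⟩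
        ∣ support K ∣ + ∣ support K' ∣  ≤⟨ disjoint⇒∣p∣+∣q∣≤∣r∣ disjoint supports⊆ ⟩
        ∣ support E ∣                   ≡⟨ ∣support∣≡∣E∣ ⟩
        ∣ E ∣                           ≤⟨ covered-by E⊆K∪K' ⟩
        ∣ K ∣ + ∣ K' ∣                  ∎)
      where
      open ≤-Reasoning
      K⊂E : ∣ K ∣ < ∣ E ∣
      K⊂E = p⊂q⇒∣p∣<∣q∣ (K⊆E , f , K'⊆E f∈K' ,
              λ f∈K → disjoint (support⁺ f∈K (inj₁ refl)) (support⁺ f∈K' (inj₁ refl)))
      K'⊂E : ∣ K' ∣ < ∣ E ∣
      K'⊂E = p⊂q⇒∣p∣<∣q∣ (K'⊆E , e , K⊆E e∈K ,
              λ e∈K' → disjoint (support⁺ e∈K (inj₁ refl)) (support⁺ e∈K' (inj₁ refl)))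
      supports⊆ : support K ∪ support K' ⊆ support E
      supports⊆ v∈ with x∈p∪q⁻ (support K) (support K') v∈
      ... | inj₁ v∈K  = support-mono K⊆E v∈K
      ... | inj₂ v∈K' = support-mono K'⊆E v∈K'

    -- Split E by whether an edge starts inside the component of src e.
    connected : ∀ e f → e ∈ E → f ∈ E → Reach G E (src G e) (src G f)
    connected e f e∈E f∈E = decide (src G f ∈? component)
      where
      open Component E (src G e)
      inside? : Decidable (λ g → g ∈ E × src G g ∈ component)
      inside? g = (g ∈? E) ×-dec (src G g ∈? component)
      outside? : Decidable (λ g → g ∈ E × src G g ∉ component)
      outside? g = (g ∈? E) ×-dec ¬? (src G g ∈? component)
      K K' : Subset (m G)
      K  = ⟦ inside? ⟧
      K' = ⟦ outside? ⟧
      support-K-inside : ∀ {v} → v ∈ support K → v ∈ component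
      support-K-inside v∈ with support⁻ v∈
      ... | g , g∈K , touches with ∈⟦⟧⁻ inside? g∈K | touches
      ...   | g∈E , g-in | inj₁ refl = g-in
      ...   | g∈E , g-in | inj₂ refl = proj₁ (component-saturated g g∈E) g-in
      support-K'-outside : ∀ {v} → v ∈ support K' → v ∉ component
      support-K'-outside v∈ with support⁻ v∈
      ... | g , g∈K' , touches with ∈⟦⟧⁻ outside? g∈K' | touches
      ...   | g∈E , g-out | inj₁ refl = g-out
      ...   | g∈E , g-out | inj₂ refl = λ t∈ → g-out (proj₂ (component-saturated g g∈E) t∈)
      E⊆K∪K' : E ⊆ K ∪ K'
      E⊆K∪K' {g} g∈E with src G g ∈? component
      ... | yes g-in  = x∈p∪q⁺ (inj₁ (∈⟦⟧⁺ inside? (g∈E , g-in)))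
      ... | no  g-out = x∈p∪q⁺ (inj₂ (∈⟦⟧⁺ outside? (g∈E , g-out)))
      decide : Dec (src G f ∈ component) → Reach G E (src G e) (src G f)
      decide (yes f-in)  = component-reach f-in
      decide (no  f-out) = ⊥-elim (no-split K K'
        (λ g∈K → proj₁ (∈⟦⟧⁻ inside? g∈K)) (λ g∈K' → proj₁ (∈⟦⟧⁻ outside? g∈K')) E⊆K∪K'
        (e , ∈⟦⟧⁺ inside? (e∈E , s₀∈component)) (f , ∈⟦⟧⁺ outside? (f∈E , f-out))
        (λ v∈K v∈K' → support-K'-outside v∈K' (support-K-inside v∈K)))

    is-cycle : IsCycle G E
    is-cycle = proj₁ dense , two-regular , connected

  -- In an acyclic edge set every nonempty subgraph has fewer edges than
  -- vertices: otherwise a minimal dense subset would be a cycle.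
  forest-bound : ∀ {F Vs Es} → Acyclic F → Closed G Vs Es → Es ⊆ F → Nonempty Es → ∣ Es ∣ < ∣ Vs ∣
  forest-bound {F} {Vs} {Es} acyclic closed Es⊆F nonempty with ∣ Es ∣ <? ∣ Vs ∣
  ... | yes fewer = fewer
  ... | no ¬fewer
      with minimal-subset (λ E → (E ⊆? F) ×-dec dense? E)
             (Es⊆F , nonempty , ≤-trans (p⊆q⇒∣p∣≤∣q∣ (closed⇒support⊆ closed)) (≮⇒≥ ¬fewer))
  ...   | E , (E⊆F , E-dense) , minimal = ⊥-elim (acyclic E E⊆F
          (MinimalDense.is-cycle E E-dense λ E' E'⊆E E'-dense → minimal E' (⊆-trans E'⊆E E⊆F , E'-dense)))

  unique-cycle-minus-edge : ∀ {M C c} → (∀ C' → C' ⊆ M → IsCycle G C' → C' ≡ C) → c ∈ C →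
    Acyclic (M - c)
  unique-cycle-minus-edge {M} {C} {c} unique c∈C C' C'⊆M-c C'-cycle =
    x∉p-x M c (C'⊆M-c (subst (c ∈_) (sym (unique C' (⊆-trans C'⊆M-c (p─q⊆p M ⁅ c ⁆)) C'-cycle)) c∈C))

  forest-count : ∀ {F Vs Es} → Acyclic F → Closed G Vs Es → Nonempty Es → ∣ Es ∩ F ∣ + 1 ≤ ∣ Vs ∣
  forest-count {F} {Vs} {Es} acyclic closed (e , e∈Es) with nonempty? (Es ∩ F)
  ... | yes nonempty = ≤-trans (≤-reflexive (+-comm _ 1))
          (forest-bound acyclic (closed-⊆ (p∩q⊆p Es F) closed) (p∩q⊆q Es F) nonempty)
  ... | no empty rewrite ∣empty∣≡0 empty = x∈p⇒1≤∣p∣ (proj₁ (closed e e∈Es))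

module TwoForests (G : Graph) {F₁ F₂ : Subset (m G)} (c : Fin (m G))
                  (acyclic₁ : Forests.Acyclic G F₁) (acyclic₂ : Forests.Acyclic G F₂)
                  (cover : ∀ e → e ≢ c → e ∈ F₁ ⊎ e ∈ F₂) where
  open Forests G

  two-forests-count : ∀ {Vs Es} → Closed G Vs Es → Nonempty Es →
    (∣ Es ∩ F₁ ∣ + 1) + (∣ Es ∩ F₂ ∣ + 1) ≤ 2 * ∣ Vs ∣
  two-forests-count {Vs} closed nonempty =
    ≤-trans (+-mono-≤ (forest-count acyclic₁ closed nonempty) (forest-count acyclic₂ closed nonempty))
            (≤-reflexive (cong (∣ Vs ∣ +_) (sym (+-identityʳ ∣ Vs ∣))))

  split : ∀ {Es e} → e ∈ Es → e ≢ c → e ∈ (Es ∩ F₁) ∪ (Es ∩ F₂)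
  split {Es} {e} e∈Es e≢c with cover e e≢c
  ... | inj₁ e∈F₁ = x∈p∪q⁺ (inj₁ (x∈p∩q⁺ (e∈Es , e∈F₁)))
  ... | inj₂ e∈F₂ = x∈p∪q⁺ (inj₂ (x∈p∩q⁺ (e∈Es , e∈F₂)))

  sparse-2-2 : SparseOn G 2 2 ⊤ (⊤ - c)
  sparse-2-2 Vs Es _ Es⊆⊤-c closed nonempty = begin
    ∣ Es ∣ + 2                               ≤⟨ +-monoˡ-≤ 2 (covered-by Es⊆) ⟩
    ∣ Es ∩ F₁ ∣ + ∣ Es ∩ F₂ ∣ + 2            ≡⟨ regroup ∣ Es ∩ F₁ ∣ ∣ Es ∩ F₂ ∣ ⟩
    (∣ Es ∩ F₁ ∣ + 1) + (∣ Es ∩ F₂ ∣ + 1)    ≤⟨ two-forests-count closed nonempty ⟩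
    2 * ∣ Vs ∣                               ∎
    where
    open ≤-Reasoning
    regroup : ∀ a b → a + b + 2 ≡ (a + 1) + (b + 1)
    regroup = solve-∀
    Es⊆ : Es ⊆ (Es ∩ F₁) ∪ (Es ∩ F₂)
    Es⊆ e∈ = split e∈ (x∈p-y⇒x≢y (Es⊆⊤-c e∈))

  -- G itself is (2,1)-sparse: only the edge c is not covered.
  sparse-2-1 : SparseOn G 2 1 ⊤ ⊤
  sparse-2-1 Vs Es _ _ closed nonempty = begin
    ∣ Es ∣ + 1                                 ≤⟨ +-monoˡ-≤ 1 (covered-by Es⊆) ⟩
    ∣ Es ∩ F₁ ∣ + ∣ (Es ∩ F₂) ∪ ⁅ c ⁆ ∣ + 1
      ≤⟨ +-monoˡ-≤ 1 (+-monoʳ-≤ ∣ Es ∩ F₁ ∣ (∣p∪q∣≤∣p∣+∣q∣ (Es ∩ F₂) ⁅ c ⁆)) ⟩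
    ∣ Es ∩ F₁ ∣ + (∣ Es ∩ F₂ ∣ + ∣ ⁅ c ⁆ ∣) + 1
      ≡⟨ cong (λ x → ∣ Es ∩ F₁ ∣ + (∣ Es ∩ F₂ ∣ + x) + 1) (∣⁅x⁆∣≡1 c) ⟩
    ∣ Es ∩ F₁ ∣ + (∣ Es ∩ F₂ ∣ + 1) + 1        ≡⟨ regroup ∣ Es ∩ F₁ ∣ ∣ Es ∩ F₂ ∣ ⟩
    (∣ Es ∩ F₁ ∣ + 1) + (∣ Es ∩ F₂ ∣ + 1)      ≤⟨ two-forests-count closed nonempty ⟩
    2 * ∣ Vs ∣                                 ∎
    where
    open ≤-Reasoning
    regroup : ∀ a b → a + (b + 1) + 1 ≡ (a + 1) + (b + 1)
    regroup = solve-∀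
    Es⊆ : Es ⊆ (Es ∩ F₁) ∪ ((Es ∩ F₂) ∪ ⁅ c ⁆)
    Es⊆ {e} e∈ with e ≟ c
    ... | yes refl = x∈p∪q⁺ (inj₂ (x∈p∪q⁺ (inj₂ (x∈⁅x⁆ c))))
    ... | no  e≢c with x∈p∪q⁻ (Es ∩ F₁) (Es ∩ F₂) (split e∈ e≢c)
    ...   | inj₁ e∈₁ = x∈p∪q⁺ (inj₁ e∈₁)
    ...   | inj₂ e∈₂ = x∈p∪q⁺ (inj₂ (x∈p∪q⁺ (inj₁ e∈₂)))

module Circuits (G : Graph) (sparse-2-1 : SparseOn G 2 1 ⊤ ⊤) where
  open Subgraphs G

  Overfull : Subset (m G) → Set
  Overfull Es = ∃ λ Vs → Closed G Vs Es × Nonempty Es × 2 * ∣ Vs ∣ ≤ ∣ Es ∣ + 1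

  overfull? : Decidable Overfull
  overfull? Es = anySubset? λ Vs →
    all? (λ e → (e ∈? Es) →-dec ((src G e ∈? Vs) ×-dec (tgt G e ∈? Vs)))
    ×-dec nonempty? Es ×-dec (2 * ∣ Vs ∣ ≤? ∣ Es ∣ + 1)

  count-minus-edge : ∀ {Vs : Subset (n G)} {Es : Subset (m G)} {f} → f ∈ Es →
    ∣ Es ∣ + 1 ≡ 2 * ∣ Vs ∣ → ∣ Es - f ∣ + 2 ≡ 2 * ∣ Vs ∣
  count-minus-edge {Vs} {Es} {f} f∈Es count = begin
    ∣ Es - f ∣ + 2        ≡⟨ +-assoc ∣ Es - f ∣ 1 1 ⟨
    ∣ Es - f ∣ + 1 + 1    ≡⟨ cong (_+ 1) (∣p-x∣+1≡∣p∣ f∈Es) ⟩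
    ∣ Es ∣ + 1            ≡⟨ count ⟩
    2 * ∣ Vs ∣            ∎
    where open ≡-Reasoning

  -- An overfull edge set of minimal size spans a (2,2)-circuit: by
  -- (2,1)-sparsity it has exactly 2|V| - 1 edges, and every subgraph missing
  -- one of its edges is not overfull by minimality, hence (2,2)-sparse.
  circuit-exists : ∀ {Es} → Overfull Es →
    Σ (Subset (n G) × Subset (m G)) λ H → Circuit22 G (proj₁ H) (proj₂ H)
  circuit-exists overfull with minimal-subset overfull? overfull
  ... | E , (V , closed , nonempty , 2∣V∣≤∣E∣+1) , minimal = (V , E) , closed , count , tight
    where
    count : ∣ E ∣ + 1 ≡ 2 * ∣ V ∣
    count = ≤-antisym (sparse-2-1 V E (λ _ → ∈⊤) (λ _ → ∈⊤) closed nonempty) 2∣V∣≤∣E∣+1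
    tight : ∀ f → f ∈ E → TightOn G 2 2 V (E - f)
    tight f f∈E = sparse , count-minus-edge {V} f∈E count
      where
      sparse : SparseOn G 2 2 V (E - f)
      sparse V' E' _ E'⊆E-f closed' nonempty' with 2 * ∣ V' ∣ ≤? ∣ E' ∣ + 1
      ... | yes overfull' = contradiction
              (≤-trans (s≤s (p⊆q⇒∣p∣≤∣q∣ E'⊆E-f)) (x∈p⇒∣p-x∣<∣p∣ f∈E))
              (minimal E' (V' , closed' , nonempty' , overfull'))
      ... | no  ¬overfull' = ≤-trans (≤-reflexive (+-suc ∣ E' ∣ 1)) (≰⇒> ¬overfull')

  -- No subgraph without edges has |Es| = 2|Vs| - 1 (parity).
  1≢2* : ∀ k → 1 ≢ 2 * k
  1≢2* zero    ()
  1≢2* (suc k) 1≡2+2k = 0≢1+n (trans (suc-injective 1≡2+2k) (+-suc k (k + 0)))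

  module Unique (c : Fin (m G)) (sparse-2-2 : SparseOn G 2 2 ⊤ (⊤ - c)) where

    circuit-∋c : ∀ {Vs Es} → Circuit22 G Vs Es → c ∈ Es
    circuit-∋c {Vs} {Es} (closed , count , _) with c ∈? Es | nonempty? Es
    ... | yes c∈Es | _ = c∈Es
    ... | no  c∉Es | no empty = ⊥-elim (1≢2* ∣ Vs ∣ (trans (cong (_+ 1) (sym (∣empty∣≡0 empty))) count))
    ... | no  c∉Es | yes nonempty = ⊥-elim (<-irrefl count (begin-strict
      ∣ Es ∣ + 1   <⟨ ≤-reflexive (sym (+-suc ∣ Es ∣ 1)) ⟩
      ∣ Es ∣ + 2   ≤⟨ sparse-2-2 Vs Es (λ _ → ∈⊤) Es⊆⊤-c closed nonempty ⟩
      2 * ∣ Vs ∣   ∎))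
      where
      open ≤-Reasoning
      Es⊆⊤-c : Es ⊆ ⊤ - c
      Es⊆⊤-c e∈Es = x∈p∧x≢y⇒x∈p-y ∈⊤ λ { refl → c∉Es e∈Es }

    -- Two circuits share c, so their intersection is a nonempty subgraph.
    -- If an edge f of the first were missing from the second, the
    -- intersection would sit in (first circuit) - f, and the counts
    -- |E₁ ∩ E₂| + 2 ≤ 2|V₁ ∩ V₂| and |E₁ ∪ E₂| + 1 ≤ 2|V₁ ∪ V₂| would add
    -- up to more than |E₁| + |E₂| + 2 = 2|V₁| + 2|V₂|.
    circuit-edges-⊆ : ∀ {V₁ E₁ V₂ E₂} → Circuit22 G V₁ E₁ → Circuit22 G V₂ E₂ → E₁ ⊆ E₂
    circuit-edges-⊆ {V₁} {E₁} {V₂} {E₂} C₁@(closed₁ , count₁ , tight₁) C₂@(closed₂ , count₂ , _) {f} f∈E₁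
      with f ∈? E₂
    ... | yes f∈E₂ = f∈E₂
    ... | no  f∉E₂ = ⊥-elim (<-irrefl refl (begin-strict
      ∣ E₁ ∪ E₂ ∣ + ∣ E₁ ∩ E₂ ∣ + 2            <⟨ ≤-reflexive (regroup ∣ E₁ ∪ E₂ ∣ ∣ E₁ ∩ E₂ ∣) ⟩
      (∣ E₁ ∪ E₂ ∣ + 1) + (∣ E₁ ∩ E₂ ∣ + 2)    ≤⟨ +-mono-≤ union-count intersection-count ⟩
      2 * ∣ V₁ ∪ V₂ ∣ + 2 * ∣ V₁ ∩ V₂ ∣        ≡⟨ *-distribˡ-+ 2 ∣ V₁ ∪ V₂ ∣ ∣ V₁ ∩ V₂ ∣ ⟨
      2 * (∣ V₁ ∪ V₂ ∣ + ∣ V₁ ∩ V₂ ∣)          ≡⟨ cong (2 *_) (∣p∪q∣+∣p∩q∣≡∣p∣+∣q∣ V₁ V₂) ⟩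
      2 * (∣ V₁ ∣ + ∣ V₂ ∣)                    ≡⟨ *-distribˡ-+ 2 ∣ V₁ ∣ ∣ V₂ ∣ ⟩
      2 * ∣ V₁ ∣ + 2 * ∣ V₂ ∣                  ≡⟨ cong₂ _+_ count₁ count₂ ⟨
      (∣ E₁ ∣ + 1) + (∣ E₂ ∣ + 1)              ≡⟨ pair-up ∣ E₁ ∣ ∣ E₂ ∣ ⟩
      ∣ E₁ ∣ + ∣ E₂ ∣ + 2                      ≡⟨ cong (_+ 2) (∣p∪q∣+∣p∩q∣≡∣p∣+∣q∣ E₁ E₂) ⟨
      ∣ E₁ ∪ E₂ ∣ + ∣ E₁ ∩ E₂ ∣ + 2            ∎))
      where
      open ≤-Reasoning
      regroup : ∀ u i → suc (u + i + 2) ≡ (u + 1) + (i + 2)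
      regroup = solve-∀
      pair-up : ∀ a b → (a + 1) + (b + 1) ≡ a + b + 2
      pair-up = solve-∀
      c∈E₁∩E₂ : c ∈ E₁ ∩ E₂
      c∈E₁∩E₂ = x∈p∩q⁺ (circuit-∋c C₁ , circuit-∋c C₂)
      E₁∩E₂⊆E₁-f : E₁ ∩ E₂ ⊆ E₁ - f
      E₁∩E₂⊆E₁-f e∈ with x∈p∩q⁻ E₁ E₂ e∈
      ... | e∈E₁ , e∈E₂ = x∈p∧x≢y⇒x∈p-y e∈E₁ λ { refl → f∉E₂ e∈E₂ }
      intersection-count : ∣ E₁ ∩ E₂ ∣ + 2 ≤ 2 * ∣ V₁ ∩ V₂ ∣
      intersection-count = proj₁ (tight₁ f f∈E₁) (V₁ ∩ V₂) (E₁ ∩ E₂)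
        (p∩q⊆p V₁ V₂) E₁∩E₂⊆E₁-f (closed-∩ closed₁ closed₂) (c , c∈E₁∩E₂)
      union-count : ∣ E₁ ∪ E₂ ∣ + 1 ≤ 2 * ∣ V₁ ∪ V₂ ∣
      union-count = sparse-2-1 (V₁ ∪ V₂) (E₁ ∪ E₂) (λ _ → ∈⊤) (λ _ → ∈⊤) (closed-∪ closed₁ closed₂)
        (c , x∈p∪q⁺ (inj₁ (circuit-∋c C₁)))

    -- A circuit's vertex set is determined by its edges: any subgraph
    -- (V₂ , E) shares all vertices of the circuit (V₁ , E), since
    -- (V₁ ∩ V₂ , E) is a subgraph that (2,1)-sparsity forces to be as large.
    circuit-vertices-⊆ : ∀ {V₁ V₂ E} → Circuit22 G V₁ E → Closed G V₂ E → V₁ ⊆ V₂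
    circuit-vertices-⊆ {V₁} {V₂} {E} C₁@(closed₁ , count₁ , _) closed₂ =
      ∣p∣≤∣p∩q∣⇒p⊆q V₁ V₂ (*-cancelˡ-≤ 2 (begin
        2 * ∣ V₁ ∣         ≡⟨ count₁ ⟨
        ∣ E ∣ + 1          ≤⟨ sparse-2-1 (V₁ ∩ V₂) E (λ _ → ∈⊤) (λ _ → ∈⊤) closed∩ (c , circuit-∋c C₁) ⟩
        2 * ∣ V₁ ∩ V₂ ∣    ∎))
      where
      open ≤-Reasoning
      closed∩ : Closed G (V₁ ∩ V₂) E
      closed∩ = closed-⊆ (λ e∈E → x∈p∩q⁺ (e∈E , e∈E)) (closed-∩ closed₁ closed₂)

    circuit-unique : ∀ {V₁ E₁ V₂ E₂} → Circuit22 G V₁ E₁ → Circuit22 G V₂ E₂ → (V₁ , E₁) ≡ (V₂ , E₂)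
    circuit-unique C₁ C₂ with ⊆-antisym (circuit-edges-⊆ C₁ C₂) (circuit-edges-⊆ C₂ C₁)
    ... | refl = cong (_, _) (⊆-antisym (circuit-vertices-⊆ C₁ (proj₁ C₂)) (circuit-vertices-⊆ C₂ (proj₁ C₁)))

lemma3p4 : (G : Graph) →
    m G + 1 ≡ 2 * n G →
    (T M : Subset (m G)) → T ∩ M ≡ ⊥ → T ∪ M ≡ ⊤ →
    SpanningTree G T → ConnectedSpanningMapGraph G M →
    P21 G ×
    Σ (Subset (n G) × Subset (m G)) λ H →
      Circuit22 G (proj₁ H) (proj₂ H) ×
      (∀ Vs Es → Circuit22 G Vs Es → (Vs , Es) ≡ H)
lemma3p4 G |E|+1≡2|V| T M _ T∪M≡⊤ (_ , T-acyclic) (_ , C , _ , C-cycle , C-unique) =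
  ((sparse-2-1 , count) , c , sparse-2-2 , count-minus-edge {⊤} ∈⊤ count) ,
  proj₁ circuit , proj₂ circuit , λ Vs Es C′ → circuit-unique C′ (proj₂ circuit)
  where
  c : Fin (m G)
  c = proj₁ (proj₁ C-cycle)
  cover : ∀ e → e ≢ c → e ∈ T ⊎ e ∈ M - c
  cover e e≢c with x∈p∪q⁻ T M (subst (e ∈_) (sym T∪M≡⊤) ∈⊤)
  ... | inj₁ e∈T = inj₁ e∈T
  ... | inj₂ e∈M = inj₂ (x∈p∧x≢y⇒x∈p-y e∈M e≢c)
  open TwoForests G c T-acyclic (Forests.unique-cycle-minus-edge G C-unique (proj₂ (proj₁ C-cycle))) cover
  open Circuits G sparse-2-1
  open Unique c sparse-2-2
  count : ∣ ⊤ {m G} ∣ + 1 ≡ 2 * ∣ ⊤ {n G} ∣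
  count rewrite ∣⊤∣≡n (m G) | ∣⊤∣≡n (n G) = |E|+1≡2|V|
  circuit : Σ (Subset (n G) × Subset (m G)) λ H → Circuit22 G (proj₁ H) (proj₂ H)
  circuit = circuit-exists (⊤ , (λ _ _ → ∈⊤ , ∈⊤) , (c , ∈⊤) , ≤-reflexive (sym count))
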